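{- Let $G=G_1+G_2+\cdots+G_l$ be a simple graph where each $G_i=(T_1^i(w_1^i),\dots,T_{m_i}^i(w_{m_i}^i))$ with each $T_j^i$ a tree. Let $D=D_1+\cdots+D_l$ be an oriented graph obtained from $G$ by choosing a strong orientation of each of its cycles (and any orientation of the other edges), with $\mathrm{und}(D_i)=G_i$; denote by $C_{m_i}^+$ the cycle of $D_i$, with vertices $a_1^i,\dots,a_{m_i}^i$ (where $a_j^i$ is identified with $w_j^i$) and arcs $(a_j^i,a_{j+1}^i)$, $(a_{m_i}^i,a_1^i)$. Let $\Gamma$ be a family of 1-regular digraphs all with the same vertex set $V$, let $h:E(D)\to\Gamma$ be any function, and let $h_i^\xi=h|_{E(C_{m_i}^+)}$. For each $i$ let $P_{h_i^\xi}=h(a_{m_i}^ia_1^i)\cdots h(a_2^ia_3^i)\cdot h(a_1^ia_2^i)$ (composition of permutations, $h(a_1^ia_2^i)$ applied first), with disjoint cyclic decomposition $\sigma_1^i\cdots\sigma_{s_i}^i$ (including cycles of length $1$), and let $|\sigma_j^i|$ be the length of $\sigma_j^i$. Then $$\mathrm{und}(D\otimes_h\Gamma)\cong\sum_{i=1}^l\sum_{j=1}^{s_i}\big(T_1^i(w_1^i),T_2^i(w_2^i),\dots,T_{m_i}^i(w_{m_i}^i)\big)^{|\sigma_j^i|}.$$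
   Context: Notation: for trees $T_1,\dots,T_m$ (each of order $\ge1$) and $w_j\in V(T_j)$, $(T_1(w_1),\dots,T_m(w_m))$ is the unicyclic graph obtained from a cycle $a_1\cdots a_m$ and disjoint copies of the $T_j$ by identifying $w_j$ with $a_j$; $(T_1(w_1),\dots,T_m(w_m))^k$ is the same construction with the sequence of $m$ entries repeated $k$ times (cycle length $mk$). Sums denote disjoint unions. A 1-regular digraph on $V$ (all in-/out-degrees $1$) is identified with the permutation $\pi$ with $\pi(x)=y$ iff $(x,y)$ is an arc. Product: for a digraph $D$, a family $\Gamma$ of digraphs with common vertex set $V$ and $h:E(D)\to\Gamma$, $D\otimes_h\Gamma$ has vertex set $V(D)\times V$ and $((a,x),(b,y))$ is an arc iff $(a,b)\in E(D)$ and $(x,y)\in E(h(a,b))$. $\mathrm{und}$ is underlying graph. -}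

module Defs where

open import Data.Nat using (ℕ; zero; suc; _*_; _≤_; _<_)
open import Data.Nat.DivMod using (m%n<n)
open import Data.Fin using (Fin; zero; suc; toℕ; fromℕ<; remainder)
open import Data.Bool using (Bool; true; false)
open import Data.Product using (Σ; Σ-syntax; _×_; _,_; proj₁; proj₂)
open import Data.Sum using (_⊎_)
open import Data.Empty using (⊥)
open import Function using (_∘_; id)
open import Function.Bundles using (_↔_; _⇔_; Inverse)
open import Function.Definitions using (Injective; Bijective)
open import Relation.Binary.PropositionalEquality using (_≡_)
open import Relation.Binary.Construct.Closure.ReflexiveTransitive using (Star)
open import Relation.Nullary using (¬_)

record Graph : Set₁ where
  field
    V : Set
    E : V → V → Set

record Digraph : Set₁ where
  field
    V : Set
    A : V → V → Set

open Graph
open Digraph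

_≅_ : Graph → Graph → Set
G ≅ H = Σ[ f ∈ V G ↔ V H ] (∀ x y → E G x y ⇔ E H (Inverse.to f x) (Inverse.to f y))

und : Digraph → Graph
und D = record { V = V D ; E = λ x y → A D x y ⊎ A D y x }

data SumE {J : Set} (G : J → Graph) : Σ J (λ j → V (G j)) → Σ J (λ j → V (G j)) → Set where
  inn : ∀ j {x y} → E (G j) x y → SumE G (j , x) (j , y)

⨁ : (J : Set) → (J → Graph) → Graph
⨁ J G = record { V = Σ J (λ j → V (G j)) ; E = SumE G }

-- Permutations of Fin N (= 1-regular digraphs on Fin N)

Perm : ℕ → Set
Perm N = Fin N ↔ Fin N

_⊗[_]_ : {I : Set} {N : ℕ} (D : Digraph) → (∀ {a b} → A D a b → I) → (I → Perm N) → Digraph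
_⊗[_]_ {N = N} D h Γ = record
  { V = V D × Fin N
  ; A = λ { (a , x) (b , y) → Σ[ e ∈ A D a b ] (Inverse.to (Γ (h e)) x ≡ y) } }

sucMod : ∀ {L} → Fin L → Fin L
sucMod {suc L} i = fromℕ< (m%n<n (suc (toℕ i)) (suc L))

record IsTree (n : ℕ) (adj : Fin n → Fin n → Bool) : Set where
  field
    symmetric   : ∀ x y → adj x y ≡ adj y x
    irreflexive : ∀ x → adj x x ≡ false
    connected   : ∀ x y → Star (λ a b → adj a b ≡ true) x y
    acyclic     : ¬ (Σ[ k ∈ ℕ ] Σ[ c ∈ (Fin k → Fin n) ]
                      (3 ≤ k × Injective _≡_ _≡_ c × (∀ i → adj (c i) (c (sucMod i)) ≡ true)))

record RTree : Set where
  field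
    n      : ℕ
    adj    : Fin n → Fin n → Bool
    isTree : IsTree n adj
    root   : Fin n

open RTree

-- Unicyclic graph (T_0(w_0), ..., T_{L-1}(w_{L-1})) : cycle on positions
-- Fin L, tree T p hung at position p by its root.

data UniE {L : ℕ} (T : Fin L → RTree) : Σ (Fin L) (λ p → Fin (n (T p))) → Σ (Fin L) (λ p → Fin (n (T p))) → Set where
  tr  : ∀ p {x y} → adj (T p) x y ≡ true → UniE T (p , x) (p , y)
  cyF : ∀ p → UniE T (p , root (T p)) (sucMod p , root (T (sucMod p)))
  cyB : ∀ p → UniE T (sucMod p , root (T (sucMod p))) (p , root (T p))

Uni : (L : ℕ) → (Fin L → RTree) → Graph
Uni L T = record { V = Σ (Fin L) (λ p → Fin (n (T p))) ; E = UniE T }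

-- (T_0(w_0), ..., T_{m-1}(w_{m-1}))^k : the sequence repeated k times
UniPow : (m : ℕ) → (Fin m → RTree) → (k : ℕ) → Graph
UniPow m T k = Uni (k * m) (λ p → T (remainder {k} m p))

record IsOrientation {n : ℕ} (adj O : Fin n → Fin n → Bool) : Set where
  field
    onEdges : ∀ x y → O x y ≡ true → adj x y ≡ true
    covers  : ∀ x y → adj x y ≡ true → (O x y ≡ true) ⊎ (O y x ≡ true)
    antisym : ∀ x y → O x y ≡ true → O y x ≡ true → ⊥

module Setup (l : ℕ) (m : Fin l → ℕ) (T : (i : Fin l) → Fin (m i) → RTree) where

  GG : Graph
  GG = ⨁ (Fin l) (λ i → Uni (m i) (T i))

  VD : Set
  VD = V GG

  data DArc (O : (i : Fin l) (p : Fin (m i)) → Fin (n (T i p)) → Fin (n (T i p)) → Bool) : VD → VD → Set where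
    tr : ∀ i p {x y} → O i p x y ≡ true → DArc O (i , p , x) (i , p , y)
    cy : ∀ i p → DArc O (i , p , root (T i p)) (i , sucMod p , root (T i (sucMod p)))

  DD : (O : (i : Fin l) (p : Fin (m i)) → Fin (n (T i p)) → Fin (n (T i p)) → Bool) → Digraph
  DD O = record { V = VD ; A = DArc O }

-- composition f_{L-1} ∘ ... ∘ f_1 ∘ f_0 (f_0 applied first)

cycProd : ∀ {A : Set} (L : ℕ) → (Fin L → A → A) → A → A
cycProd zero    f = id
cycProd (suc L) f = cycProd L (f ∘ suc) ∘ f zero

-- Cycle r is (elt r 0, elt r 1, ..., elt r (len r - 1)); every element of
-- Fin N occurs in exactly one cycle at exactly one position.

record CycleDecomp {N : ℕ} (P : Fin N → Fin N) : Set where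
  field
    s    : ℕ
    len  : Fin s → ℕ
    len≥1 : ∀ r → 1 ≤ len r
    elt  : (r : Fin s) → Fin (len r) → Fin N
    step : ∀ r i → P (elt r i) ≡ elt r (sucMod i)
    bij  : Bijective _≡_ _≡_ (λ (ri : Σ (Fin s) (λ r → Fin (len r))) → elt (proj₁ ri) (proj₂ ri))

module Submission where

-- Over each component D_i, the lift und(D_i ⊗_h Γ) is the derived graph of the voltages
-- Γ ∘ h.  A closed walk in a tree is either a backtrack or contains a shorter closed walk,
-- so all walks between two tree vertices carry the same voltage; composing voltages along
-- the path to the root, and then along the cycle by the prefix products π_{p-1}⋯π_0,
-- relabels every fibre so that all arcs act trivially except the one closing the cycle,
-- which acts by P_{h_i^ξ}.  Reading the fibre through the cycle decomposition of P, the lift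
-- splits into one k-fold cyclic cover of (T_1(w_1),…,T_m(w_m)) per cycle of P of length k.

open import Defs
open import Data.Nat using (ℕ; zero; suc; _+_; _*_; _≤_; _<_; z≤n; s≤s; _%_)
open import Data.Nat.Properties using (m≤m+n; m≤n+m; m≤n⇒m≤1+n; ≤-trans; +-suc)
open import Data.Nat.DivMod using (m<n⇒m%n≡m; n%n≡0)
open import Data.Nat.Induction using (<-rec)
open import Data.Nat.Tactic.RingSolver using (solve-∀)
open import Data.Fin using (Fin; zero; suc; toℕ; fromℕ; inject₁; combine; remQuot; quotient; remainder)
open import Data.Fin.Properties
  using (toℕ-injective; toℕ-fromℕ<; toℕ-inject₁; toℕ-fromℕ; toℕ<n; toℕ-combine; remQuot-combine;
         combine-remQuot; any?)
  renaming (_≟_ to _≟ᶠ_)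
open import Data.Fin.Relation.Unary.Top using (view; ‵fromℕ; ‵inject₁)
open import Data.Bool using (Bool; true; false)
open import Data.Bool.Properties using () renaming (_≟_ to _≟ᵇ_)
open import Data.Product using (Σ; Σ-syntax; ∃; _×_; _,_; proj₁; proj₂)
open import Data.Sum using (_⊎_; inj₁; inj₂)
open import Data.Empty using (⊥-elim)
open import Function using (_∘_)
open import Function.Bundles using (_↔_; Inverse; Equivalence; mk↔ₛ′; mk⇔; mk⤖)
open import Function.Properties.Bijection using (⤖⇒↔)
open import Function.Construct.Composition using (_↔-∘_; _⇔-∘_)
open import Function.Construct.Identity using (↔-id)
open import Function.Construct.Symmetry using (↔-sym)
open import Function.Definitions using (Injective)
open import Relation.Nullary using (¬_; yes; no)
open import Relation.Binary.PropositionalEquality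
  using (_≡_; refl; sym; trans; cong; cong₂; subst; subst₂; module ≡-Reasoning)
open import Relation.Binary.Construct.Closure.ReflexiveTransitive using (Star; ε; _◅_)
open import Axiom.UniquenessOfIdentityProofs using (module Decidable⇒UIP)

open Graph
open RTree
open Inverse using (to; from; strictlyInverseˡ; strictlyInverseʳ)

mk≅ : (G H : Graph) (f : V G ↔ V H) →
      (∀ {x y} → E G x y → E H (to f x) (to f y)) →
      (∀ {c d} → E H c d → E G (from f c) (from f d)) → G ≅ H
mk≅ G H f preserve reflect = f , λ x y →
  mk⇔ preserve (λ e → subst₂ (E G) (strictlyInverseʳ f x) (strictlyInverseʳ f y) (reflect e))

≅-trans : {G H K : Graph} → G ≅ H → H ≅ K → G ≅ K
≅-trans (f , f-edges) (g , g-edges) = g ↔-∘ f , λ x y → g-edges _ _ ⇔-∘ f-edges x y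

≅-reflect : {G H : Graph} ((f , _) : G ≅ H) → ∀ {c d} → E H c d → E G (from f c) (from f d)
≅-reflect {H = H} (f , f-edges) {c} {d} e =
  Equivalence.from (f-edges _ _) (subst₂ (E H) (sym (strictlyInverseˡ f c)) (sym (strictlyInverseˡ f d)) e)

⨁-cong : {J : Set} {G H : J → Graph} → (∀ j → G j ≅ H j) → ⨁ J G ≅ ⨁ J H
⨁-cong {J} {G} {H} isos = mk≅ (⨁ J G) (⨁ J H) vertices preserve reflect
  where
  vertices : V (⨁ J G) ↔ V (⨁ J H)
  vertices = mk↔ₛ′ (λ (j , x) → j , to (proj₁ (isos j)) x) (λ (j , y) → j , from (proj₁ (isos j)) y)
    (λ (j , y) → cong (j ,_) (strictlyInverseˡ (proj₁ (isos j)) y))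
    (λ (j , x) → cong (j ,_) (strictlyInverseʳ (proj₁ (isos j)) x))
  preserve : ∀ {x y} → SumE G x y → SumE H (to vertices x) (to vertices y)
  preserve (inn j e) = inn j (Equivalence.to (proj₂ (isos j) _ _) e)
  reflect : ∀ {c d} → SumE H c d → SumE G (from vertices c) (from vertices d)
  reflect (inn j e) = inn j (≅-reflect {G j} {H j} (isos j) e)

commute-from : {A B C D : Set} (f : A ↔ B) (g : C ↔ D) {h : A → C} {k : B → D} →
               (∀ a → to g (h a) ≡ k (to f a)) → ∀ b → h (from f b) ≡ from g (k b)
commute-from f g {h} {k} commute b = begin
  h (from f b)                    ≡⟨ strictlyInverseʳ g _ ⟨
  from g (to g (h (from f b)))    ≡⟨ cong (from g) (commute (from f b)) ⟩
  from g (k (to f (from f b)))    ≡⟨ cong (λ a → from g (k a)) (strictlyInverseˡ f b) ⟩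
  from g (k b)                    ∎
  where open ≡-Reasoning

sucMod-no-wrap : ∀ {L} (i c : Fin (suc L)) → suc (toℕ i) ≡ toℕ c → sucMod i ≡ c
sucMod-no-wrap {L} i c eq = toℕ-injective (begin
  toℕ (sucMod i)         ≡⟨ toℕ-fromℕ< _ ⟩
  suc (toℕ i) % suc L    ≡⟨ cong (_% suc L) eq ⟩
  toℕ c % suc L          ≡⟨ m<n⇒m%n≡m (toℕ<n c) ⟩
  toℕ c                  ∎)
  where open ≡-Reasoning

sucMod-wrap : ∀ {L} (i : Fin (suc L)) → suc (toℕ i) ≡ suc L → sucMod i ≡ zero
sucMod-wrap {L} i eq = toℕ-injective (trans (toℕ-fromℕ< _) (trans (cong (_% suc L) eq) (n%n≡0 (suc L))))

sucMod-inject₁ : ∀ {L} (i : Fin L) → sucMod (inject₁ i) ≡ suc i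
sucMod-inject₁ i = sucMod-no-wrap (inject₁ i) (suc i) (cong suc (toℕ-inject₁ i))

sucMod-fromℕ : ∀ L → sucMod (fromℕ L) ≡ zero
sucMod-fromℕ L = sucMod-wrap (fromℕ L) (cong suc (toℕ-fromℕ L))

HasCycle : ∀ {n} → (Fin n → Fin n → Bool) → Set
HasCycle {n} adj = Σ[ k ∈ ℕ ] Σ[ c ∈ (Fin k → Fin n) ]
  (3 ≤ k × Injective _≡_ _≡_ c × (∀ i → adj (c i) (c (sucMod i)) ≡ true))

module ClosedWalks {A : Set} {n : ℕ} (adj : Fin n → Fin n → Bool)
  (irreflexive : ∀ x → adj x x ≡ false) (acyclic : ¬ HasCycle adj)
  (Step : Fin n → Fin n → Set) (step-adj : ∀ {x y} → Step x y → adj x y ≡ true)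
  (act : ∀ {x y} → Step x y → A → A)
  (act-backtrack : ∀ {x y} (s : Step x y) (s′ : Step y x) v → act s′ (act s v) ≡ v) where

  infixr 5 _∷_ _++_

  data Walk : Fin n → Fin n → ℕ → Set where
    []  : ∀ {x} → Walk x x 0
    _∷_ : ∀ {x y z k} → Step x y → Walk y z k → Walk x z (suc k)

  voltage : ∀ {x z k} → Walk x z k → A → A
  voltage []      v = v
  voltage (s ∷ w) v = voltage w (act s v)

  _++_ : ∀ {x y z k₁ k₂} → Walk x y k₁ → Walk y z k₂ → Walk x z (k₁ + k₂)
  []      ++ w = w
  (s ∷ u) ++ w = s ∷ (u ++ w)

  voltage-++ : ∀ {x y z k₁ k₂} (u : Walk x y k₁) (w : Walk y z k₂) v →
               voltage (u ++ w) v ≡ voltage w (voltage u v)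
  voltage-++ []      w v = refl
  voltage-++ (s ∷ u) w v = voltage-++ u w (act s v)

  vertex : ∀ {x z k} → Walk x z k → Fin (suc k) → Fin n
  vertex {x} w       zero    = x
  vertex     (s ∷ w) (suc i) = vertex w i

  vertex-adj : ∀ {x z k} (w : Walk x z k) (i : Fin k) →
               adj (vertex w (inject₁ i)) (vertex w (suc i)) ≡ true
  vertex-adj (s ∷ w) zero    = step-adj s
  vertex-adj (s ∷ w) (suc i) = vertex-adj w i

  vertex-last : ∀ {x z k} (w : Walk x z k) → vertex w (fromℕ k) ≡ z
  vertex-last []      = refl
  vertex-last (s ∷ w) = vertex-last w

  record Split {x z k} (w : Walk x z k) (y : Fin n) : Set where
    constructor split
    field
      k₁ k₂    : ℕ
      prefix   : Walk x y k₁
      suffix   : Walk y z k₂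
      length   : k₁ + k₂ ≡ k
      voltage≡ : ∀ v → voltage w v ≡ voltage suffix (voltage prefix v)

  splitAt : ∀ {x z k} (w : Walk x z k) (i : Fin (suc k)) → Split w (vertex w i)
  splitAt {k = k} w       zero    = split 0 k [] w refl (λ _ → refl)
  splitAt         (s ∷ w) (suc i) with splitAt w i
  ... | split k₁ k₂ u t len eq = split (suc k₁) k₂ (s ∷ u) t (cong suc len) (λ v → eq (act s v))

  record Detour {x z k} (w : Walk x z k) : Set where
    constructor detour
    field
      {y}      : Fin n
      k₁ k₂ k₃ : ℕ
      before   : Walk x y k₁
      loop     : Walk y y k₂
      after    : Walk y z k₃
      loop-≤   : k₂ ≤ k
      rest-<   : k₁ + k₃ < k
      voltage≡ : ∀ v → voltage w v ≡ voltage after (voltage loop (voltage before v))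

  detour-∷ : ∀ {x y z k} (s : Step x y) {w : Walk y z k} → Detour w → Detour (s ∷ w)
  detour-∷ s (detour k₁ k₂ k₃ before loop after loop-≤ rest-< eq) =
    detour (suc k₁) k₂ k₃ (s ∷ before) loop after (m≤n⇒m≤1+n loop-≤) (s≤s rest-<) (λ v → eq (act s v))

  revisit : ∀ {x y z k} (s : Step x y) {w : Walk y z k} → Split w x → Detour (s ∷ w)
  revisit s (split k₁ k₂ u t len eq) =
    detour 0 (suc k₁) k₂ [] (s ∷ u) t (s≤s (subst (k₁ ≤_) len (m≤m+n k₁ k₂)))
           (s≤s (subst (k₂ ≤_) len (m≤n+m k₂ k₁))) (λ v → eq (act s v))

  fresh-∷ : ∀ {x y z k} (s : Step x y) (w : Walk y z k) → Injective _≡_ _≡_ (vertex w) →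
            ¬ ∃ (λ i → x ≡ vertex w i) → Injective _≡_ _≡_ (vertex (s ∷ w))
  fresh-∷ s w inj fresh {zero}  {zero}  _  = refl
  fresh-∷ s w inj fresh {zero}  {suc j} eq = ⊥-elim (fresh (j , eq))
  fresh-∷ s w inj fresh {suc i} {zero}  eq = ⊥-elim (fresh (i , sym eq))
  fresh-∷ s w inj fresh {suc i} {suc j} eq = cong suc (inj eq)

  detour-or-simple : ∀ {x z k} (w : Walk x z k) → Detour w ⊎ Injective _≡_ _≡_ (vertex w)
  detour-or-simple []               = inj₂ λ { {zero} {zero} _ → refl }
  detour-or-simple (_∷_ {x} s w) with detour-or-simple w
  ... | inj₁ d   = inj₁ (detour-∷ s d)
  ... | inj₂ inj with any? (λ i → x ≟ᶠ vertex w i)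
  ...   | yes (i , x≡) = inj₁ (revisit s (subst (Split w) (sym x≡) (splitAt w i)))
  ...   | no fresh     = inj₂ (fresh-∷ s w inj fresh)

  simple-cycle-voltage : ∀ {x y k} (s : Step x y) (w : Walk y x k) → Injective _≡_ _≡_ (vertex w) →
                         ∀ v → voltage w (act s v) ≡ v
  simple-cycle-voltage {x} s [] _ _ with trans (sym (step-adj s)) (irreflexive x)
  ... | ()
  simple-cycle-voltage s (s′ ∷ []) _ v = act-backtrack s s′ v
  simple-cycle-voltage {k = suc (suc k)} s w@(_ ∷ _ ∷ _) inj _ =
    ⊥-elim (acyclic (suc (suc (suc k)) , vertex w , s≤s (s≤s (s≤s z≤n)) , inj , around))
    where
    around : ∀ i → adj (vertex w i) (vertex w (sucMod i)) ≡ true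
    around i with view i
    ... | ‵fromℕ = subst₂ (λ a b → adj a b ≡ true) (sym (vertex-last w))
                          (cong (vertex w) (sym (sucMod-fromℕ (suc (suc k))))) (step-adj s)
    ... | ‵inject₁ j = subst (λ b → adj (vertex w (inject₁ j)) (vertex w b) ≡ true)
                             (sym (sucMod-inject₁ j)) (vertex-adj w j)

  closed-voltage : ∀ {x k} (w : Walk x x k) v → voltage w v ≡ v
  closed-voltage {k = k} = <-rec (λ k → ∀ {x} (w : Walk x x k) v → voltage w v ≡ v) shorter k
    where
    shorter : ∀ k → (∀ {j} → j < k → ∀ {x} (w : Walk x x j) v → voltage w v ≡ v) →
              ∀ {x} (w : Walk x x k) v → voltage w v ≡ v
    shorter _ _ [] v = refl
    shorter (suc k) ih (s ∷ w) v with detour-or-simple w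
    ... | inj₂ inj = simple-cycle-voltage s w inj v
    ... | inj₁ (detour k₁ k₂ k₃ before loop after loop-≤ rest-< eq) = begin
      voltage w (act s v)                                  ≡⟨ eq (act s v) ⟩
      voltage after (voltage loop (voltage before (act s v))) ≡⟨ cong (voltage after) (ih (s≤s loop-≤) loop _) ⟩
      voltage after (voltage (s ∷ before) v)               ≡⟨ voltage-++ (s ∷ before) after v ⟨
      voltage ((s ∷ before) ++ after) v                    ≡⟨ ih (s≤s rest-<) ((s ∷ before) ++ after) v ⟩
      v                                                    ∎
      where open ≡-Reasoning

  round-trip : ∀ {x y k k′} (u : Walk x y k) (w : Walk y x k′) v → voltage w (voltage u v) ≡ v
  round-trip u w v = trans (sym (voltage-++ u w v)) (closed-voltage (u ++ w) v)

module TreeGauge {A : Set} (t : RTree) (O : Fin (n t) → Fin (n t) → Bool)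
                 (isO : IsOrientation (adj t) O) (τ : ∀ {x y} → O x y ≡ true → A ↔ A) where
  open IsTree (isTree t)
  open IsOrientation isO

  data Step (x y : Fin (n t)) : Set where
    forward  : O x y ≡ true → Step x y
    backward : O y x ≡ true → Step x y

  act : ∀ {x y} → Step x y → A → A
  act (forward o)  = to (τ o)
  act (backward o) = from (τ o)

  step-adj : ∀ {x y} → Step x y → adj t x y ≡ true
  step-adj {x} {y} (forward o)  = onEdges x y o
  step-adj {x} {y} (backward o) = trans (symmetric x y) (onEdges y x o)

  orientation-irrelevant : ∀ {x y} (o o′ : O x y ≡ true) → o ≡ o′
  orientation-irrelevant = Decidable⇒UIP.≡-irrelevant _≟ᵇ_

  act-backtrack : ∀ {x y} (s : Step x y) (s′ : Step y x) v → act s′ (act s v) ≡ v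
  act-backtrack {x} {y} (forward o)  (forward o′)  v = ⊥-elim (antisym x y o o′)
  act-backtrack {x} {y} (backward o) (backward o′) v = ⊥-elim (antisym y x o o′)
  act-backtrack (forward o) (backward o′) v =
    trans (cong (λ q → from (τ q) (to (τ o) v)) (orientation-irrelevant o′ o)) (strictlyInverseʳ (τ o) v)
  act-backtrack (backward o) (forward o′) v =
    trans (cong (λ q → to (τ q) (from (τ o) v)) (orientation-irrelevant o′ o)) (strictlyInverseˡ (τ o) v)

  open ClosedWalks (adj t) irreflexive acyclic Step step-adj act act-backtrack

  star→walk : ∀ {x y} → Star (λ a b → adj t a b ≡ true) x y → Σ ℕ (Walk x y)
  star→walk ε = 0 , []
  star→walk {x} (_◅_ {j = y} e path) with covers x y e
  ... | inj₁ o = suc (proj₁ (star→walk path)) , forward o ∷ proj₂ (star→walk path)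
  ... | inj₂ o = suc (proj₁ (star→walk path)) , backward o ∷ proj₂ (star→walk path)

  walk-between : ∀ x y → Walk x y (proj₁ (star→walk (connected x y)))
  walk-between x y = proj₂ (star→walk (connected x y))

  voltage-unique : ∀ {x y k k′} (u : Walk x y k) (u′ : Walk x y k′) v → voltage u v ≡ voltage u′ v
  voltage-unique {x} {y} u u′ v =
    trans (cong (voltage u) (sym (round-trip u′ back v))) (round-trip back u (voltage u′ v))
    where back = walk-between y x

  gauge : Fin (n t) → A ↔ A
  gauge x = mk↔ₛ′ (voltage to-root) (voltage from-root)
                  (round-trip from-root to-root) (round-trip to-root from-root)
    where
    to-root = walk-between x (root t)
    from-root = walk-between (root t) x

  gauge-root : ∀ v → to (gauge (root t)) v ≡ v
  gauge-root = closed-voltage (walk-between (root t) (root t))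

  gauge-arc : ∀ {x y} (o : O x y ≡ true) v → to (gauge y) (to (τ o) v) ≡ to (gauge x) v
  gauge-arc {x} {y} o = voltage-unique (forward o ∷ walk-between y (root t)) (walk-between x (root t))

carry-digit : ∀ m j → suc (suc m * j + m) ≡ suc m * suc j + 0
carry-digit = solve-∀

last-digit : ∀ m k → suc (suc m * k + m) ≡ suc k * suc m
last-digit = solve-∀

-- The k-fold cover of the cycle of (T₀,…,T_{m-1}): positions are pairs
-- (layer j, position p), and leaving the last position moves to the next layer.
module Layered {m′ : ℕ} (T : Fin (suc m′) → RTree) where

  nextLayer : ∀ {k} → Fin k → Fin (suc m′) → Fin k
  nextLayer j p with view p
  ... | ‵fromℕ     = sucMod j
  ... | ‵inject₁ _ = j

  LayeredV : ℕ → Set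
  LayeredV k = Fin k × Σ (Fin (suc m′)) (λ p → Fin (n (T p)))

  data LayeredE {k : ℕ} : LayeredV k → LayeredV k → Set where
    tr  : ∀ j p {x y} → adj (T p) x y ≡ true → LayeredE (j , p , x) (j , p , y)
    cyF : ∀ j p → LayeredE (j , p , root (T p)) (nextLayer j p , sucMod p , root (T (sucMod p)))
    cyB : ∀ j p → LayeredE (nextLayer j p , sucMod p , root (T (sucMod p))) (j , p , root (T p))

  Layered : ℕ → Graph
  Layered k = record { V = LayeredV k ; E = LayeredE }

  sucMod-combine : ∀ {k} (j : Fin k) (p : Fin (suc m′)) →
                   sucMod (combine j p) ≡ combine (nextLayer j p) (sucMod p)
  sucMod-combine {suc k} j p with view p
  ... | ‵inject₁ p′ = trans (sucMod-no-wrap _ (combine j (suc p′)) carry-free)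
                            (cong (combine j) (sym (sucMod-inject₁ p′)))
    where
    carry-free : suc (toℕ (combine j (inject₁ p′))) ≡ toℕ (combine j (suc p′))
    carry-free rewrite toℕ-combine j (inject₁ p′) | toℕ-inject₁ p′ | toℕ-combine j (suc p′) =
      sym (+-suc (suc m′ * toℕ j) (toℕ p′))
  ... | ‵fromℕ with view j
  ...   | ‵inject₁ j′ = trans (sucMod-no-wrap _ (combine (suc j′) zero) carry)
                              (cong₂ combine (sym (sucMod-inject₁ j′)) (sym (sucMod-fromℕ m′)))
    where
    carry : suc (toℕ (combine (inject₁ j′) (fromℕ m′))) ≡ toℕ (combine (suc j′) (zero {m′}))
    carry rewrite toℕ-combine (inject₁ j′) (fromℕ m′) | toℕ-inject₁ j′ | toℕ-fromℕ m′
                | toℕ-combine (suc j′) (zero {m′}) = carry-digit m′ (toℕ j′)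
  ...   | ‵fromℕ = trans (sucMod-wrap _ overflow)
                         (cong₂ combine (sym (sucMod-fromℕ k)) (sym (sucMod-fromℕ m′)))
    where
    overflow : suc (toℕ (combine (fromℕ k) (fromℕ m′))) ≡ suc k * suc m′
    overflow rewrite toℕ-combine (fromℕ k) (fromℕ m′) | toℕ-fromℕ k | toℕ-fromℕ m′ = last-digit m′ k

  module _ (k : ℕ) where
    private
      F : Fin (suc m′) → Set
      F p = Fin (n (T p))
      quo : Fin (k * suc m′) → Fin k
      quo = quotient {k} (suc m′)
      rem : Fin (k * suc m′) → Fin (suc m′)
      rem = remainder {k} (suc m′)

      U : Graph
      U = UniPow (suc m′) T k

    rem-combine : ∀ j p → rem (combine j p) ≡ p
    rem-combine j p = cong proj₂ (remQuot-combine {k} j p)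

    remQuot-sucMod : ∀ q → remQuot {k} (suc m′) (sucMod q)
                           ≡ (nextLayer (quo q) (rem q) , sucMod (rem q))
    remQuot-sucMod q = begin
      remQuot (suc m′) (sucMod q)
        ≡⟨ cong (remQuot (suc m′) ∘ sucMod) (combine-remQuot {k} (suc m′) q) ⟨
      remQuot (suc m′) (sucMod (combine (quo q) (rem q)))
        ≡⟨ cong (remQuot (suc m′)) (sucMod-combine (quo q) (rem q)) ⟩
      remQuot (suc m′) (combine (nextLayer (quo q) (rem q)) (sucMod (rem q)))
        ≡⟨ remQuot-combine {k} _ _ ⟩
      (nextLayer (quo q) (rem q) , sucMod (rem q))
        ∎
      where open ≡-Reasoning

    positions : LayeredV k ↔ V U
    positions = mk↔ₛ′ flatten unflatten flatten∘unflatten unflatten∘flatten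
      where
      flatten : LayeredV k → V U
      flatten (j , p , x) = combine j p , subst F (sym (rem-combine j p)) x
      unflatten : V U → LayeredV k
      unflatten (q , x) = quo q , rem q , x

      reindex : ∀ {q′ q} (e : q′ ≡ q) (e′ : rem q′ ≡ rem q) (x : F (rem q)) →
                _≡_ {A = V U} (q′ , subst F (sym e′) x) (q , x)
      reindex refl e′ x rewrite Decidable⇒UIP.≡-irrelevant _≟ᶠ_ e′ refl = refl
      flatten∘unflatten : ∀ qx → flatten (unflatten qx) ≡ qx
      flatten∘unflatten (q , x) = reindex (combine-remQuot {k} (suc m′) q) _ x
      unflatten∘flatten : ∀ jpx → unflatten (flatten jpx) ≡ jpx
      unflatten∘flatten (j , p , x) = unpair (remQuot-combine {k} j p)
        where
        unpair : ∀ {jp} (e : jp ≡ (j , p)) →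
                 _≡_ {A = LayeredV k} (proj₁ jp , proj₂ jp , subst F (sym (cong proj₂ e)) x) (j , p , x)
        unpair refl = refl

    layered≅UniPow : Layered k ≅ U
    layered≅UniPow = mk≅ (Layered k) U positions preserve reflect
      where
      tree-edge : ∀ {q p x y} (e : rem q ≡ p) → adj (T p) x y ≡ true →
                  E U (q , subst F (sym e) x) (q , subst F (sym e) y)
      tree-edge refl a = tr _ a

      cycle-edges : ∀ {q q′ p p′} (e : rem q ≡ p) (e′ : rem q′ ≡ p′) → sucMod q ≡ q′ →
                    let a = (q , subst F (sym e) (root (T p))) ; b = (q′ , subst F (sym e′) (root (T p′)))
                    in E U a b × E U b a
      cycle-edges refl refl refl = cyF _ , cyB _

      preserve : ∀ {a b} → LayeredE a b → E U (to positions a) (to positions b)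
      preserve (tr j p a) = tree-edge (rem-combine j p) a
      preserve (cyF j p)  = proj₁ (cycle-edges (rem-combine j p) (rem-combine _ _) (sucMod-combine j p))
      preserve (cyB j p)  = proj₂ (cycle-edges (rem-combine j p) (rem-combine _ _) (sucMod-combine j p))

      layer-edges : ∀ j p (jp′ : Fin k × Fin (suc m′)) → jp′ ≡ (nextLayer j p , sucMod p) →
                    let a = (j , p , root (T p)) ; b = (proj₁ jp′ , proj₂ jp′ , root (T (proj₂ jp′)))
                    in LayeredE a b × LayeredE b a
      layer-edges j p _ refl = cyF j p , cyB j p

      reflect : ∀ {c d} → E U c d → LayeredE (from positions c) (from positions d)
      reflect (tr q a) = tr (quo q) (rem q) a
      reflect (cyF q)  = proj₁ (layer-edges (quo q) (rem q) _ (remQuot-sucMod q))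
      reflect (cyB q)  = proj₂ (layer-edges (quo q) (rem q) _ (remQuot-sucMod q))

prefix : ∀ {N L} → (Fin L → Perm N) → Fin (suc L) → Perm N
prefix             f zero    = ↔-id _
prefix {L = suc L} f (suc k) = prefix (f ∘ suc) k ↔-∘ f zero

prefix-suc : ∀ {N L} (f : Fin L → Perm N) (k : Fin L) v →
             to (prefix f (suc k)) v ≡ to (f k) (to (prefix f (inject₁ k)) v)
prefix-suc f zero    v = refl
prefix-suc f (suc k) v = prefix-suc (f ∘ suc) k (to (f zero) v)

prefix-last : ∀ {N} L (f : Fin L → Perm N) v → to (prefix f (fromℕ L)) v ≡ cycProd L (to ∘ f) v
prefix-last zero    f v = refl
prefix-last (suc L) f v = prefix-last L (f ∘ suc) (to (f zero) v)

module _ {m : ℕ} (T : Fin m → RTree) (O : (p : Fin m) → Fin (n (T p)) → Fin (n (T p)) → Bool) where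

  data UniArc : V (Uni m T) → V (Uni m T) → Set where
    tr : ∀ p {x y} → O p x y ≡ true → UniArc (p , x) (p , y)
    cy : ∀ p → UniArc (p , root (T p)) (sucMod p , root (T (sucMod p)))

  UniDigraph : Digraph
  UniDigraph = record { V = V (Uni m T) ; A = UniArc }

module Component {m′ N : ℕ} {I : Set} (T : Fin (suc m′) → RTree)
                 (O : (p : Fin (suc m′)) → Fin (n (T p)) → Fin (n (T p)) → Bool)
                 (isO : ∀ p → IsOrientation (adj (T p)) (O p))
                 (Γ : I → Perm N) (h : ∀ {a b} → UniArc T O a b → I)
                 (dec : CycleDecomp (cycProd (suc m′) (λ p → to (Γ (h (cy p)))))) where
  open CycleDecomp dec
  open Layered T using (nextLayer; Layered; LayeredE; tr; cyF; cyB)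

  τ : ∀ p {x y} → O p x y ≡ true → Perm N
  τ p o = Γ (h (tr p o))

  π : Fin (suc m′) → Perm N
  π p = Γ (h (cy p))

  module Gauge (p : Fin (suc m′)) = TreeGauge (T p) (O p) (isO p) (τ p)

  CyclePos : Set
  CyclePos = Σ (Fin s) (λ r → Fin (len r))

  cycles : CyclePos ↔ Fin N
  cycles = ⤖⇒↔ (mk⤖ bij)

  next : Fin (suc m′) → CyclePos → CyclePos
  next p (r , j) = r , nextLayer j p

  -- to (frame p) (r , j) = π_{p-1}(⋯ π_0 (elt r j)); going once around the cycle of D_i
  -- applies P, which moves elt r j one step along its cycle.
  frame : Fin (suc m′) → CyclePos ↔ Fin N
  frame p = prefix π (inject₁ p) ↔-∘ cycles

  frame-step : ∀ p c → to (frame (sucMod p)) (next p c) ≡ to (π p) (to (frame p) c)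
  frame-step p (r , j) with view p
  ... | ‵inject₁ p′ = trans (cong (λ q → to (frame q) (r , j)) (sucMod-inject₁ p′))
                            (prefix-suc π (inject₁ p′) (elt r j))
  ... | ‵fromℕ = begin
    to (frame (sucMod (fromℕ m′))) (r , sucMod j)     ≡⟨ cong (λ q → to (frame q) _) (sucMod-fromℕ m′) ⟩
    elt r (sucMod j)                                  ≡⟨ step r j ⟨
    cycProd (suc m′) (to ∘ π) (elt r j)               ≡⟨ prefix-last (suc m′) π (elt r j) ⟨
    to (prefix π (suc (fromℕ m′))) (elt r j)          ≡⟨ prefix-suc π (fromℕ m′) (elt r j) ⟩
    to (π (fromℕ m′)) (to (frame (fromℕ m′)) (r , j)) ∎
    where open ≡-Reasoning

  -- The relabelling of the fibre over (p , x) that turns the lift into the cover.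
  coord : ∀ p → Fin (n (T p)) → Fin N ↔ CyclePos
  coord p x = ↔-sym (frame p) ↔-∘ Gauge.gauge p x

  coord-tree : ∀ p {x y} (o : O p x y ≡ true) v → to (coord p y) (to (τ p o) v) ≡ to (coord p x) v
  coord-tree p o v = cong (from (frame p)) (Gauge.gauge-arc p o v)

  coord-cycle : ∀ p v → to (coord (sucMod p) (root (T (sucMod p)))) (to (π p) v)
                        ≡ next p (to (coord p (root (T p))) v)
  coord-cycle p v = begin
    from (frame (sucMod p)) (to (Gauge.gauge (sucMod p) _) (to (π p) v))
      ≡⟨ cong (from (frame (sucMod p))) (Gauge.gauge-root (sucMod p) _) ⟩
    from (frame (sucMod p)) (to (π p) v)
      ≡⟨ commute-from (frame p) (frame (sucMod p)) (frame-step p) v ⟨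
    next p (from (frame p) v)
      ≡⟨ cong (next p ∘ from (frame p)) (Gauge.gauge-root p v) ⟨
    next p (from (frame p) (to (Gauge.gauge p _) v))
      ∎
    where open ≡-Reasoning

  Cover : Graph
  Cover = ⨁ (Fin s) (λ r → Layered (len r))

  Lift : Graph
  Lift = und (UniDigraph T O ⊗[ h ] Γ)

  positions : V Lift ↔ V Cover
  positions = mk↔ₛ′ (λ ((p , x) , v) → let (r , j) = to (coord p x) v in r , j , p , x)
                    (λ (r , j , p , x) → (p , x) , from (coord p x) (r , j))
                    (λ (r , j , p , x) → cong (λ (r , j) → r , j , p , x) (strictlyInverseˡ (coord p x) (r , j)))
                    (λ ((p , x) , v) → cong ((p , x) ,_) (strictlyInverseʳ (coord p x) v))

  cover-edges : ∀ {r j j′ a b} (c : CyclePos) → c ≡ (r , j′) →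
                LayeredE {len r} (j , a) (j′ , b) × LayeredE (j′ , b) (j , a) →
                E Cover (r , j , a) (proj₁ c , proj₂ c , b) × E Cover (proj₁ c , proj₂ c , b) (r , j , a)
  cover-edges _ refl (e , e′) = inn _ e , inn _ e′

  tree-edges : ∀ {k} (j : Fin k) p {x y} → O p x y ≡ true →
               LayeredE (j , p , x) (j , p , y) × LayeredE (j , p , y) (j , p , x)
  tree-edges j p {x} {y} o = tr j p x~y , tr j p (trans (IsTree.symmetric (isTree (T p)) y x) x~y)
    where x~y = IsOrientation.onEdges (isO p) x y o

  preserve : ∀ {a b} → E Lift a b → E Cover (to positions a) (to positions b)
  preserve {(_ , v)} (inj₁ (tr p o , refl)) = proj₁ (cover-edges _ (coord-tree p o v) (tree-edges _ p o))
  preserve {_} {(_ , v)} (inj₂ (tr p o , refl)) = proj₂ (cover-edges _ (coord-tree p o v) (tree-edges _ p o))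
  preserve {(_ , v)} (inj₁ (cy p , refl)) = proj₁ (cover-edges _ (coord-cycle p v) (cyF _ p , cyB _ p))
  preserve {_} {(_ , v)} (inj₂ (cy p , refl)) = proj₂ (cover-edges _ (coord-cycle p v) (cyF _ p , cyB _ p))

  coord⁻¹-tree : ∀ p {x y} (o : O p x y ≡ true) c → to (τ p o) (from (coord p x) c) ≡ from (coord p y) c
  coord⁻¹-tree p o = commute-from (coord p _) (coord p _) (coord-tree p o)

  coord⁻¹-cycle : ∀ p c → to (π p) (from (coord p (root (T p))) c)
                          ≡ from (coord (sucMod p) (root (T (sucMod p)))) (next p c)
  coord⁻¹-cycle p = commute-from (coord p _) (coord (sucMod p) _) (coord-cycle p)

  reflect : ∀ {c d} → E Cover c d → E Lift (from positions c) (from positions d)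
  reflect (inn r (tr j p {x} {y} x~y)) with IsOrientation.covers (isO p) x y x~y
  ... | inj₁ o = inj₁ (tr p o , coord⁻¹-tree p o (r , j))
  ... | inj₂ o = inj₂ (tr p o , coord⁻¹-tree p o (r , j))
  reflect (inn r (cyF j p)) = inj₁ (cy p , coord⁻¹-cycle p (r , j))
  reflect (inn r (cyB j p)) = inj₂ (cy p , coord⁻¹-cycle p (r , j))

  lift≅cover : Lift ≅ Cover
  lift≅cover = mk≅ Lift Cover positions preserve reflect

  lift≅UniPows : Lift ≅ ⨁ (Fin s) (λ r → UniPow (suc m′) T (len r))
  lift≅UniPows = ≅-trans {Lift} {Cover} {⨁ (Fin s) UniPows} lift≅cover
    (⨁-cong {G = λ r → Layered (len r)} {H = UniPows} (λ r → Layered.layered≅UniPow T (len r)))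
    where
    UniPows : Fin s → Graph
    UniPows r = UniPow (suc m′) T (len r)

unicyclic-lift≅ : ∀ {m N} {I : Set} → 1 ≤ m → (T : Fin m → RTree)
  (O : (p : Fin m) → Fin (n (T p)) → Fin (n (T p)) → Bool) → (∀ p → IsOrientation (adj (T p)) (O p)) →
  (Γ : I → Perm N) (h : ∀ {a b} → UniArc T O a b → I)
  (dec : CycleDecomp (cycProd m (λ p → to (Γ (h (cy p)))))) →
  und (UniDigraph T O ⊗[ h ] Γ) ≅ ⨁ (Fin (CycleDecomp.s dec)) (λ r → UniPow m T (CycleDecomp.len dec r))
unicyclic-lift≅ {suc m′} _ = Component.lift≅UniPows

module _ {l : ℕ} {m : Fin l → ℕ} {T : (i : Fin l) → Fin (m i) → RTree}
         {O : (i : Fin l) (p : Fin (m i)) → Fin (n (T i p)) → Fin (n (T i p)) → Bool} where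
  open Setup l m T

  restrict : ∀ i {a b} → UniArc (T i) (O i) a b → DArc O (i , a) (i , b)
  restrict i (tr p o) = tr i p o
  restrict i (cy p)   = cy i p

  ⊗-components : {I : Set} {N : ℕ} (Γ : I → Perm N) (h : ∀ {a b} → DArc O a b → I) →
                 und (DD O ⊗[ h ] Γ)
                   ≅ ⨁ (Fin l) (λ i → und (UniDigraph (T i) (O i) ⊗[ (λ e → h (restrict i e)) ] Γ))
  ⊗-components {N = N} Γ h = mk≅ _ _ regroup preserve reflect
    where
    regroup : V (und (DD O ⊗[ h ] Γ)) ↔ Σ (Fin l) (λ i → V (Uni (m i) (T i)) × Fin N)
    regroup = mk↔ₛ′ (λ ((i , a) , v) → i , a , v) (λ (i , a , v) → (i , a) , v) (λ _ → refl) (λ _ → refl)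
    preserve : ∀ {x y} → E (und (DD O ⊗[ h ] Γ)) x y → SumE _ (to regroup x) (to regroup y)
    preserve (inj₁ (tr i p o , eq)) = inn i (inj₁ (tr p o , eq))
    preserve (inj₁ (cy i p , eq))   = inn i (inj₁ (cy p , eq))
    preserve (inj₂ (tr i p o , eq)) = inn i (inj₂ (tr p o , eq))
    preserve (inj₂ (cy i p , eq))   = inn i (inj₂ (cy p , eq))
    reflect : ∀ {c d} → SumE _ c d → E (und (DD O ⊗[ h ] Γ)) (from regroup c) (from regroup d)
    reflect (inn i (inj₁ (tr p o , eq))) = inj₁ (tr i p o , eq)
    reflect (inn i (inj₁ (cy p , eq)))   = inj₁ (cy i p , eq)
    reflect (inn i (inj₂ (tr p o , eq))) = inj₂ (tr i p o , eq)
    reflect (inn i (inj₂ (cy p , eq)))   = inj₂ (cy i p , eq)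

theorem3p3 :
    (l : ℕ) (m : Fin l → ℕ) (T : (i : Fin l) → Fin (m i) → RTree) →
    (∀ i → 3 ≤ m i) →
    (O : (i : Fin l) (p : Fin (m i)) → Fin (RTree.n (T i p)) → Fin (RTree.n (T i p)) → Bool) →
    (∀ i p → IsOrientation (RTree.adj (T i p)) (O i p)) →
    (I : Set) (N : ℕ) (Γ : I → Perm N) →
    (h : ∀ {a b} → Setup.DArc l m T O a b → I) →
    (dec : (i : Fin l) →
       CycleDecomp (cycProd (m i) (λ p → Inverse.to (Γ (h (Setup.cy i p)))))) →
    und (Setup.DD l m T O ⊗[ h ] Γ)
      ≅ ⨁ (Fin l) (λ i → ⨁ (Fin (CycleDecomp.s (dec i)))
                     (λ r → UniPow (m i) (T i) (CycleDecomp.len (dec i) r)))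
theorem3p3 l m T m≥3 O isO I N Γ h dec =
  ≅-trans {und (Setup.DD l m T O ⊗[ h ] Γ)} {⨁ (Fin l) Lift} {⨁ (Fin l) Covers}
    (⊗-components Γ h)
    (⨁-cong {G = Lift} {H = Covers} λ i →
      unicyclic-lift≅ (≤-trans (s≤s z≤n) (m≥3 i)) (T i) (O i) (isO i) Γ _ (dec i))
  where
  Lift : Fin l → Graph
  Lift i = und (UniDigraph (T i) (O i) ⊗[ (λ e → h (restrict i e)) ] Γ)
  Covers : Fin l → Graph
  Covers i = ⨁ (Fin (CycleDecomp.s (dec i))) (λ r → UniPow (m i) (T i) (CycleDecomp.len (dec i) r))
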